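{- Let $n \ge 2$. The mean statistics of the excedance number and the weak excedance number on $\mathfrak{S}_n$ decompose into irreducible characters as \[ \overline{\mathrm{exc}} = \frac{n-1}{2}\chi^{(n)} - \frac{1}{2}\chi^{(n-1,1)} \qquad\text{and}\qquad \overline{\mathrm{wexc}} = \frac{n+1}{2}\chi^{(n)} + \frac{1}{2}\chi^{(n-1,1)}. \]
   Context: For $\pi \in \mathfrak{S}_n$, an excedance of $\pi$ is an index $i \in [n]$ with $\pi(i) > i$, and a weak excedance is an index $i$ with $\pi(i) \ge i$; $\mathrm{exc}(\pi)$ and $\mathrm{wexc}(\pi)$ denote their respective numbers. For a function $\mathfrak{s}:\mathfrak{S}_n\to\mathbb{R}$, the mean statistic $\overline{\mathfrak{s}}$ is the class function whose value on a permutation of cycle type $\lambda$ is $\frac{1}{|C_\lambda|}\sum_{\pi\in C_\lambda}\mathfrak{s}(\pi)$, where $C_\lambda$ is the conjugacy class of permutations of cycle type $\lambda$. $\chi^\lambda$ denotes the irreducible character of $\mathfrak{S}_n$ indexed by the partition $\lambda \vdash n$ in the standard way; $\chi^{(n)}$ is the trivial character and $\chi^{(n-1,1)}(\pi)$ equals the number of fixed points of $\pi$ minus one. -}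

module Defs where

open import Data.Nat as ℕ using (ℕ; zero; suc)
open import Data.Fin using (Fin; toℕ)
open import Data.Fin.Properties using (_≟_)
open import Data.Fin.Permutation using (Permutation′; _⟨$⟩ʳ_)
open import Data.Vec using (Vec; []; _∷_; lookup)
open import Data.List using (List; []; _∷_; map; concatMap; filter; length; allFin)
open import Data.Nat.ListAction using (sum)
open import Data.List.Relation.Unary.All using (All)
open import Data.List.Relation.Unary.All as All using (all?)
open import Data.List.Relation.Unary.Any using (Any; any?)
open import Data.Integer using (ℤ; +_)
open import Data.Rational using (ℚ; 0ℚ; _/_)
open import Data.Product using (_×_)
open import Relation.Binary.PropositionalEquality using (_≡_)
open import Relation.Nullary using (Dec; yes; no; ¬_)
open import Relation.Nullary.Decidable using (_→-dec_)
open import Data.Bool using (true; false)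

-- Permutations of [n] = Fin n are represented (for enumeration) as bijective
-- maps Fin n → Fin n.

allVecs : (n k : ℕ) → List (Vec (Fin n) k)
allVecs n zero = [] ∷ []
allVecs n (suc k) = concatMap (λ x → map (x ∷_) (allVecs n k)) (allFin n)

allMaps : (n : ℕ) → List (Fin n → Fin n)
allMaps n = map lookup (allVecs n n)

-- a map Fin n → Fin n is a permutation iff it is injective
IsPerm : {n : ℕ} → (Fin n → Fin n) → Set
IsPerm {n} f = All (λ i → All (λ j → f i ≡ f j → i ≡ j) (allFin n)) (allFin n)

isPerm? : {n : ℕ} → (f : Fin n → Fin n) → Dec (IsPerm f)
isPerm? {n} f = all? (λ i → all? (λ j → (f i ≟ f j) →-dec (i ≟ j)) (allFin n)) (allFin n)

-- the symmetric group S_n, listed without repetition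
Sn : (n : ℕ) → List (Fin n → Fin n)
Sn n = filter isPerm? (allMaps n)

Conj : {n : ℕ} → (Fin n → Fin n) → (Fin n → Fin n) → Set
Conj {n} τ π = Any (λ σ → All (λ i → τ (σ i) ≡ σ (π i)) (allFin n)) (Sn n)

conj? : {n : ℕ} → (τ π : Fin n → Fin n) → Dec (Conj τ π)
conj? {n} τ π = any? (λ σ → all? (λ i → τ (σ i) ≟ σ (π i)) (allFin n)) (Sn n)

conjClass : {n : ℕ} → (Fin n → Fin n) → List (Fin n → Fin n)
conjClass π = filter (λ τ → conj? τ π) (Sn _)

exc : {n : ℕ} → (Fin n → Fin n) → ℕ
exc {n} π = length (filter (λ i → toℕ i ℕ.<? toℕ (π i)) (allFin n))

wexc : {n : ℕ} → (Fin n → Fin n) → ℕ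
wexc {n} π = length (filter (λ i → toℕ i ℕ.≤? toℕ (π i)) (allFin n))

fix : {n : ℕ} → (Fin n → Fin n) → ℕ
fix {n} π = length (filter (λ i → π i ≟ i) (allFin n))

-- a / d in ℚ (d = 0 never occurs below, since conjugacy classes are nonempty)
divℕ : ℕ → ℕ → ℚ
divℕ a zero = 0ℚ
divℕ a (suc d) = (+ a) / suc d

mean : {n : ℕ} → ((Fin n → Fin n) → ℕ) → (Fin n → Fin n) → ℚ
mean s π = divℕ (sum (map s (conjClass π))) (length (conjClass π))

-- the characters χ^(n) (trivial) and χ^(n-1,1) (= fixed points − 1)
χtriv : {n : ℕ} → (Fin n → Fin n) → ℚ
χtriv π = (+ 1) / 1

χstd : {n : ℕ} → (Fin n → Fin n) → ℚ
χstd π = Data.Rational._-_ ((+ fix π) / 1) ((+ 1) / 1)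

module Submission where

-- Write w₀ = opposite for the longest permutation i ↦ n − 1 − i. Conjugation by w₀
-- (the reverse-complement τ ↦ w₀ τ w₀) maps the conjugacy class C of π onto itself and
-- turns the excedances of τ into its anti-excedances (τ j < j). Every position is an
-- excedance, an anti-excedance or a fixed point, so exc τ + exc (w₀ τ w₀) + fix τ = n.
-- Summing over C, on which fix is constant, gives 2 Σ_C exc = |C| (n − fix π), that is
-- mean exc = (n − 1)/2 − (fix π − 1)/2; then wexc = exc + fix gives the second formula.

open import Defs
open import Data.Nat using (ℕ; _≤_; _∸_; _+_)
open import Data.Integer using (+_)
open import Data.Rational using (ℚ; _/_; _*_; _-_) renaming (_+_ to _+ℚ_)
open import Data.Fin.Permutation using (Permutation′; _⟨$⟩ʳ_)
open import Data.Product using (_×_)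
open import Relation.Binary.PropositionalEquality using (_≡_)

import Data.Nat as ℕ
open import Data.Nat using (zero; suc; _<_; _<?_; _≤?_; z≤n; s≤s)
import Data.Nat.Properties as ℕP
open import Algebra.Properties.CommutativeSemigroup ℕP.+-commutativeSemigroup using (interchange)
open import Data.Nat.ListAction using (sum)
open import Data.Nat.ListAction.Properties using (sum-++)
import Data.Integer as ℤ
import Data.Integer.Properties as ℤP
open import Data.Fin using (Fin; toℕ; opposite; punchOut)
import Data.Fin.Properties as FinP
open import Data.Fin.Permutation using (_⟨$⟩ˡ_; inverseˡ)
open import Data.Vec using (Vec; []; _∷_; lookup; tabulate)
import Data.Vec.Properties as VecP
open import Data.List using (List; []; _∷_; _++_; map; filter; length; allFin; concatMap)
import Data.List.Properties as ListP
open import Data.List.Membership.Propositional using (_∈_; lose; find)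
open import Data.List.Membership.Propositional.Properties using (∈-filter⁺; ∈-filter⁻; ∈-map⁺; ∈-allFin; ∈-concatMap⁺)
open import Data.List.Relation.Unary.All as All using (All)
open import Data.List.Relation.Unary.All.Properties using (all-filter)
open import Data.List.Relation.Unary.Any as Any using (here; there)
open import Data.Product using (∃; _,_; proj₁; proj₂)
open import Data.Rational using (½; 1ℚ; fromℚᵘ; toℚᵘ)
open import Data.Rational.Properties using (toℚᵘ-injective; toℚᵘ-fromℚᵘ; toℚᵘ-homo-+; toℚᵘ-homo-*; fromℚᵘ-cong; *-identityʳ)
open import Data.Rational.Solver using (module +-*-Solver)
open +-*-Solver using (solve; _:=_; _:+_; _:*_; _:-_; con)
open import Data.Rational.Unnormalised as ℚᵘ using (mkℚᵘ; *≡*)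
import Data.Rational.Unnormalised.Properties as ℚᵘP
open import Function using (_∘_)
open import Function.Definitions using (Injective)
open import Relation.Binary.Definitions using (DecidableEquality; tri<; tri≈; tri>)
open import Relation.Binary.PropositionalEquality using (refl; sym; trans; cong; cong₂; subst; subst₂; _≗_; _≢_; module ≡-Reasoning)
open import Relation.Nullary using (Dec; yes; no; ¬_; contradiction)
open import Relation.Nullary.Decidable using (_×-dec_)

private
  variable
    A B : Set
    P Q : Set

∑ : List A → (A → ℕ) → ℕ
∑ L h = sum (map h L)

infix 5 ∑
syntax ∑ L (λ x → h) = ∑[ x ∈ L ] h

∑-cong : ∀ (L : List A) {f g : A → ℕ} → f ≗ g → ∑ L f ≡ ∑ L g
∑-cong L f≗g = cong sum (ListP.map-cong f≗g L)

∑-const : ∀ (L : List A) c → ∑[ _ ∈ L ] c ≡ length L ℕ.* c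
∑-const []      c = refl
∑-const (x ∷ L) c = cong (_+_ c) (∑-const L c)

∑-+ : ∀ (L : List A) (f g : A → ℕ) → ∑[ x ∈ L ] (f x + g x) ≡ ∑ L f + ∑ L g
∑-+ []      f g = refl
∑-+ (x ∷ L) f g = trans (cong (_+_ (f x + g x)) (∑-+ L f g)) (interchange (f x) (g x) (∑ L f) (∑ L g))

∑-*ˡ : ∀ (L : List A) c (f : A → ℕ) → ∑[ x ∈ L ] (c ℕ.* f x) ≡ c ℕ.* ∑ L f
∑-*ˡ []      c f = sym (ℕP.*-zeroʳ c)
∑-*ˡ (x ∷ L) c f = trans (cong (_+_ (c ℕ.* f x)) (∑-*ˡ L c f)) (sym (ℕP.*-distribˡ-+ c (f x) (∑ L f)))

∑-*ʳ : ∀ (L : List A) c (f : A → ℕ) → ∑[ x ∈ L ] (f x ℕ.* c) ≡ ∑ L f ℕ.* c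
∑-*ʳ L c f = trans (∑-cong L (λ x → ℕP.*-comm (f x) c)) (trans (∑-*ˡ L c f) (ℕP.*-comm c (∑ L f)))

∑-swap : (L : List A) (M : List B) (f : A → B → ℕ) →
         ∑[ x ∈ L ] ∑[ y ∈ M ] f x y ≡ ∑[ y ∈ M ] ∑[ x ∈ L ] f x y
∑-swap []      M f = sym (trans (∑-const M 0) (ℕP.*-zeroʳ (length M)))
∑-swap (x ∷ L) M f = trans (cong (_+_ (∑ M (f x))) (∑-swap L M f)) (sym (∑-+ M (f x) (λ y → ∑[ x ∈ L ] f x y)))

∑-map : (L : List B) (g : B → A) (h : A → ℕ) → ∑ (map g L) h ≡ ∑ L (h ∘ g)
∑-map L g h = cong sum (sym (ListP.map-∘ L))

∑-concatMap : (L : List B) (g : B → List A) (h : A → ℕ) →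
              ∑ (concatMap g L) h ≡ ∑[ x ∈ L ] ∑ (g x) h
∑-concatMap []      g h = refl
∑-concatMap (x ∷ L) g h = begin
  sum (map h (g x ++ concatMap g L))         ≡⟨ cong sum (ListP.map-++ h (g x) (concatMap g L)) ⟩
  sum (map h (g x) ++ map h (concatMap g L)) ≡⟨ sum-++ (map h (g x)) (map h (concatMap g L)) ⟩
  ∑ (g x) h + ∑ (concatMap g L) h            ≡⟨ cong (_+_ (∑ (g x) h)) (∑-concatMap L g h) ⟩
  ∑ (g x) h + (∑[ y ∈ L ] ∑ (g y) h)         ∎
  where open ≡-Reasoning

𝟙 : Dec P → ℕ
𝟙 (yes _) = 1
𝟙 (no _)  = 0

𝟙-⇔ : (P → Q) → (Q → P) → (p? : Dec P) (q? : Dec Q) → 𝟙 p? ≡ 𝟙 q?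
𝟙-⇔ P→Q Q→P (yes p) (yes q) = refl
𝟙-⇔ P→Q Q→P (yes p) (no ¬q) = contradiction (P→Q p) ¬q
𝟙-⇔ P→Q Q→P (no ¬p) (yes q) = contradiction (Q→P q) ¬p
𝟙-⇔ P→Q Q→P (no ¬p) (no ¬q) = refl

𝟙-yes : P → (p? : Dec P) → 𝟙 p? ≡ 1
𝟙-yes p (yes _) = refl
𝟙-yes p (no ¬p) = contradiction p ¬p

𝟙-no : ¬ P → (p? : Dec P) → 𝟙 p? ≡ 0
𝟙-no ¬p (yes p) = contradiction p ¬p
𝟙-no ¬p (no _)  = refl

𝟙-×-dec : (p? : Dec P) (q? : Dec Q) → 𝟙 (p? ×-dec q?) ≡ 𝟙 p? ℕ.* 𝟙 q?
𝟙-×-dec (yes _) (yes _) = refl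
𝟙-×-dec (yes _) (no _)  = refl
𝟙-×-dec (no _)  _       = refl

module _ {R : A → Set} (R? : ∀ x → Dec (R x)) where

  ∑-filter : ∀ (L : List A) (s : A → ℕ) → ∑ (filter R? L) s ≡ ∑[ x ∈ L ] 𝟙 (R? x) ℕ.* s x
  ∑-filter []      s = refl
  ∑-filter (x ∷ L) s with R? x
  ... | yes _ = cong₂ _+_ (sym (ℕP.+-identityʳ (s x))) (∑-filter L s)
  ... | no _  = ∑-filter L s

  length-filter≡∑𝟙 : ∀ (L : List A) → length (filter R? L) ≡ ∑[ x ∈ L ] 𝟙 (R? x)
  length-filter≡∑𝟙 []      = refl
  length-filter≡∑𝟙 (x ∷ L) with R? x
  ... | yes _ = cong suc (length-filter≡∑𝟙 L)
  ... | no _  = length-filter≡∑𝟙 L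

𝟙-trichotomy : ∀ m n → 𝟙 (m <? n) + 𝟙 (n <? m) + 𝟙 (n ℕ.≟ m) ≡ 1
𝟙-trichotomy m n with ℕP.<-cmp m n
... | tri< m<n m≢n n≮m = cong₂ _+_ (cong₂ _+_ (𝟙-yes m<n (m <? n)) (𝟙-no n≮m (n <? m))) (𝟙-no (m≢n ∘ sym) (n ℕ.≟ m))
... | tri≈ m≮n m≡n n≮m = cong₂ _+_ (cong₂ _+_ (𝟙-no m≮n (m <? n)) (𝟙-no n≮m (n <? m))) (𝟙-yes (sym m≡n) (n ℕ.≟ m))
... | tri> m≮n m≢n n<m = cong₂ _+_ (cong₂ _+_ (𝟙-no m≮n (m <? n)) (𝟙-yes n<m (n <? m))) (𝟙-no (m≢n ∘ sym) (n ℕ.≟ m))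

𝟙-≤ : ∀ m n → 𝟙 (m ≤? n) ≡ 𝟙 (m <? n) + 𝟙 (n ℕ.≟ m)
𝟙-≤ m n with ℕP.<-cmp m n
... | tri< m<n m≢n _ =
  trans (𝟙-yes (ℕP.<⇒≤ m<n) (m ≤? n)) (sym (cong₂ _+_ (𝟙-yes m<n (m <? n)) (𝟙-no (m≢n ∘ sym) (n ℕ.≟ m))))
... | tri≈ m≮n m≡n _ =
  trans (𝟙-yes (ℕP.≤-reflexive m≡n) (m ≤? n)) (sym (cong₂ _+_ (𝟙-no m≮n (m <? n)) (𝟙-yes (sym m≡n) (n ℕ.≟ m))))
... | tri> m≮n m≢n n<m =
  trans (𝟙-no (ℕP.<⇒≱ n<m) (m ≤? n)) (sym (cong₂ _+_ (𝟙-no m≮n (m <? n)) (𝟙-no (m≢n ∘ sym) (n ℕ.≟ m))))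

record Enumerates (_≟_ : DecidableEquality A) (L : List A) : Set where
  constructor occurring-once
  field
    occurs-once : ∀ a → ∑[ x ∈ L ] 𝟙 (x ≟ a) ≡ 1

open Enumerates

module _ {A : Set} {_≟_ : DecidableEquality A} {L : List A} (enum : Enumerates _≟_ L) where

  ∑-select : ∀ a (h : A → ℕ) → ∑[ x ∈ L ] 𝟙 (x ≟ a) ℕ.* h x ≡ h a
  ∑-select a h = begin
    ∑[ x ∈ L ] 𝟙 (x ≟ a) ℕ.* h x   ≡⟨ ∑-cong L select ⟩
    ∑[ x ∈ L ] 𝟙 (x ≟ a) ℕ.* h a   ≡⟨ ∑-*ʳ L (h a) (λ x → 𝟙 (x ≟ a)) ⟩
    (∑[ x ∈ L ] 𝟙 (x ≟ a)) ℕ.* h a ≡⟨ cong (ℕ._* h a) (occurs-once enum a) ⟩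
    1 ℕ.* h a                      ≡⟨ ℕP.*-identityˡ (h a) ⟩
    h a                            ∎
    where
    open ≡-Reasoning
    select : ∀ x → 𝟙 (x ≟ a) ℕ.* h x ≡ 𝟙 (x ≟ a) ℕ.* h a
    select x with x ≟ a
    ... | yes refl = refl
    ... | no _     = refl

  ∑-reindex : ∀ (f g : A → A) → (∀ x → g (f x) ≡ x) → (∀ y → f (g y) ≡ y) →
              ∀ (h : A → ℕ) → ∑[ x ∈ L ] h (f x) ≡ ∑ L h
  ∑-reindex f g g∘f f∘g h = begin
    ∑[ x ∈ L ] h (f x)                          ≡⟨ ∑-cong L (λ x → ∑-select (f x) h) ⟨
    ∑[ x ∈ L ] ∑[ y ∈ L ] 𝟙 (y ≟ f x) ℕ.* h y   ≡⟨ ∑-swap L L (λ x y → 𝟙 (y ≟ f x) ℕ.* h y) ⟩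
    ∑[ y ∈ L ] ∑[ x ∈ L ] 𝟙 (y ≟ f x) ℕ.* h y   ≡⟨ ∑-cong L (λ y → ∑-*ʳ L (h y) (λ x → 𝟙 (y ≟ f x))) ⟩
    ∑[ y ∈ L ] (∑[ x ∈ L ] 𝟙 (y ≟ f x)) ℕ.* h y ≡⟨ ∑-cong L (λ y → cong (ℕ._* h y) (fibre y)) ⟩
    ∑[ y ∈ L ] 1 ℕ.* h y                        ≡⟨ ∑-cong L (λ y → ℕP.*-identityˡ (h y)) ⟩
    ∑ L h                                       ∎
    where
    open ≡-Reasoning
    fibre : ∀ y → ∑[ x ∈ L ] 𝟙 (y ≟ f x) ≡ 1
    fibre y = trans (∑-cong L (λ x → 𝟙-⇔ (λ y≡fx → sym (trans (cong g y≡fx) (g∘f x)))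
                                         (λ x≡gy → trans (sym (f∘g y)) (cong f (sym x≡gy)))
                                         (y ≟ f x) (x ≟ g y)))
                    (occurs-once enum (g y))

∑-allFin-suc : ∀ {n} (h : Fin (suc n) → ℕ) → ∑ (allFin (suc n)) h ≡ h Fin.zero + (∑[ i ∈ allFin n ] h (Fin.suc i))
∑-allFin-suc h = cong (_+_ (h Fin.zero)) (cong sum (trans (ListP.map-tabulate Fin.suc h) (sym (ListP.map-tabulate (λ i → i) (h ∘ Fin.suc)))))

allFin-enumerates : ∀ n → Enumerates FinP._≟_ (allFin n)
allFin-enumerates n = occurring-once (occurs-once-allFin n)
  where
  occurs-once-allFin : ∀ n a → ∑[ x ∈ allFin n ] 𝟙 (x FinP.≟ a) ≡ 1
  occurs-once-allFin (suc n) Fin.zero =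
    trans (∑-allFin-suc {n} (λ x → 𝟙 (x FinP.≟ Fin.zero)))
          (cong suc (trans (∑-const (allFin n) 0) (ℕP.*-zeroʳ (length (allFin n)))))
  occurs-once-allFin (suc n) (Fin.suc a) =
    trans (∑-allFin-suc {n} (λ x → 𝟙 (x FinP.≟ Fin.suc a)))
          (trans (∑-cong (allFin n) (λ i → 𝟙-⇔ FinP.suc-injective (cong Fin.suc) (Fin.suc i FinP.≟ Fin.suc a) (i FinP.≟ a)))
                 (occurs-once-allFin n a))

_≟ᵛ_ : ∀ {n k} → DecidableEquality (Vec (Fin n) k)
_≟ᵛ_ = VecP.≡-dec FinP._≟_

𝟙-∷ : ∀ {n k} (x y : Fin n) (v w : Vec (Fin n) k) → 𝟙 ((x ∷ v) ≟ᵛ (y ∷ w)) ≡ 𝟙 (x FinP.≟ y) ℕ.* 𝟙 (v ≟ᵛ w)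
𝟙-∷ x y v w with x FinP.≟ y | v ≟ᵛ w
... | yes _ | yes _ = refl
... | yes _ | no _  = refl
... | no _  | _     = refl

allVecs-enumerates : ∀ n k → Enumerates _≟ᵛ_ (allVecs n k)
allVecs-enumerates n k = occurring-once (occurs-once-allVecs n k)
  where
  occurs-once-allVecs : ∀ n k v → ∑[ w ∈ allVecs n k ] 𝟙 (w ≟ᵛ v) ≡ 1
  occurs-once-allVecs n zero    []       = refl
  occurs-once-allVecs n (suc k) (a ∷ as) = begin
    ∑[ v ∈ allVecs n (suc k) ] 𝟙 (v ≟ᵛ (a ∷ as))
      ≡⟨ ∑-concatMap (allFin n) (λ x → map (x ∷_) (allVecs n k)) (λ v → 𝟙 (v ≟ᵛ (a ∷ as))) ⟩
    ∑[ x ∈ allFin n ] ∑[ v ∈ map (x ∷_) (allVecs n k) ] 𝟙 (v ≟ᵛ (a ∷ as))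
      ≡⟨ ∑-cong (allFin n) (λ x → trans (∑-map (allVecs n k) (x ∷_) _) (∑-cong (allVecs n k) (λ v → 𝟙-∷ x a v as))) ⟩
    ∑[ x ∈ allFin n ] ∑[ v ∈ allVecs n k ] 𝟙 (x FinP.≟ a) ℕ.* 𝟙 (v ≟ᵛ as)
      ≡⟨ ∑-cong (allFin n) (λ x → trans (∑-*ˡ (allVecs n k) (𝟙 (x FinP.≟ a)) (λ v → 𝟙 (v ≟ᵛ as))) (cong (𝟙 (x FinP.≟ a) ℕ.*_) (occurs-once-allVecs n k as))) ⟩
    ∑[ x ∈ allFin n ] 𝟙 (x FinP.≟ a) ℕ.* 1
      ≡⟨ ∑-select (allFin-enumerates n) a (λ _ → 1) ⟩
    1 ∎
    where open ≡-Reasoning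

∈-allVecs : ∀ {n k} (v : Vec (Fin n) k) → v ∈ allVecs n k
∈-allVecs []      = here refl
∈-allVecs {n} {suc k} (x ∷ v) = ∈-concatMap⁺ (λ y → map (y ∷_) (allVecs n k)) (lose (∈-allFin x) (∈-map⁺ (x ∷_) (∈-allVecs v)))

∈⇒1≤length : ∀ {x : A} {L} → x ∈ L → 1 ≤ length L
∈⇒1≤length (here _)  = s≤s z≤n
∈⇒1≤length (there _) = s≤s z≤n

injective⇒surjective : ∀ {n} {σ : Fin n → Fin n} → Injective _≡_ _≡_ σ → ∀ y → ∃ λ x → σ x ≡ y
injective⇒surjective {suc n} {σ} σ-injective y with FinP.any? (λ x → σ x FinP.≟ y)
... | yes σx≡y = σx≡y
... | no  σx≢y = contradiction (FinP.injective⇒≤ punchOut∘σ-injective) ℕP.1+n≰n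
  where
  y≢σ : ∀ x → y ≢ σ x
  y≢σ x y≡σx = σx≢y (x , sym y≡σx)
  punchOut∘σ : Fin (suc n) → Fin n
  punchOut∘σ x = punchOut (y≢σ x)
  punchOut∘σ-injective : Injective _≡_ _≡_ punchOut∘σ
  punchOut∘σ-injective {x} {x′} = σ-injective ∘ FinP.punchOut-injective (y≢σ x) (y≢σ x′)

injective⇒inverse : ∀ {n} {σ : Fin n → Fin n} → Injective _≡_ _≡_ σ →
                    ∃ λ σ⁻¹ → (∀ x → σ⁻¹ (σ x) ≡ x) × (∀ y → σ (σ⁻¹ y) ≡ y)
injective⇒inverse {n} {σ} σ-injective = σ⁻¹ , (λ x → σ-injective (σ∘σ⁻¹ (σ x))) , σ∘σ⁻¹
  where
  σ⁻¹ : Fin n → Fin n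
  σ⁻¹ y = proj₁ (injective⇒surjective σ-injective y)
  σ∘σ⁻¹ : ∀ y → σ (σ⁻¹ y) ≡ y
  σ∘σ⁻¹ y = proj₂ (injective⇒surjective σ-injective y)

module _ {n : ℕ} where

  IsPerm⇒injective : ∀ {f : Fin n → Fin n} → IsPerm f → Injective _≡_ _≡_ f
  IsPerm⇒injective perm {i} {j} = All.lookup (All.lookup perm (∈-allFin i)) (∈-allFin j)

  injective⇒IsPerm : ∀ {f : Fin n → Fin n} → Injective _≡_ _≡_ f → IsPerm f
  injective⇒IsPerm f-injective = All.tabulate (λ _ → All.tabulate (λ _ → f-injective))

  injective-resp-≗ : ∀ {f g : Fin n → Fin n} → f ≗ g → Injective _≡_ _≡_ f → Injective _≡_ _≡_ g
  injective-resp-≗ f≗g f-injective gi≡gj = f-injective (trans (f≗g _) (trans gi≡gj (sym (f≗g _))))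

  tabulate-∈-Sn : ∀ {σ : Fin n → Fin n} → Injective _≡_ _≡_ σ → lookup (tabulate σ) ∈ Sn n
  tabulate-∈-Sn {σ} σ-injective =
    ∈-filter⁺ isPerm? (∈-map⁺ lookup (∈-allVecs (tabulate σ)))
              (injective⇒IsPerm (injective-resp-≗ (sym ∘ VecP.lookup∘tabulate σ) σ-injective))

  Conj⇒conjugator : ∀ {τ π : Fin n → Fin n} → Conj τ π →
                    ∃ λ σ → Injective _≡_ _≡_ σ × (∀ i → τ (σ i) ≡ σ (π i))
  Conj⇒conjugator c with σ , σ∈Sn , τσ≡σπ ← find c =
    σ , IsPerm⇒injective (proj₂ (∈-filter⁻ isPerm? {xs = allMaps n} σ∈Sn)) , λ i → All.lookup τσ≡σπ (∈-allFin i)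

  conjugator⇒Conj : ∀ {τ π σ : Fin n → Fin n} → Injective _≡_ _≡_ σ → (∀ i → τ (σ i) ≡ σ (π i)) → Conj τ π
  conjugator⇒Conj {τ} {π} {σ} σ-injective τσ≡σπ =
    lose (tabulate-∈-Sn σ-injective) (All.tabulate (λ {i} _ → begin
      τ (lookup (tabulate σ) i)  ≡⟨ cong τ (VecP.lookup∘tabulate σ i) ⟩
      τ (σ i)                    ≡⟨ τσ≡σπ i ⟩
      σ (π i)                    ≡⟨ VecP.lookup∘tabulate σ (π i) ⟨
      lookup (tabulate σ) (π i)  ∎))
    where open ≡-Reasoning

  Conj-resp-≗ : ∀ {τ τ′ π : Fin n → Fin n} → τ ≗ τ′ → Conj τ π → Conj τ′ π
  Conj-resp-≗ τ≗τ′ = Any.map (All.map (trans (sym (τ≗τ′ _))))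

  fix-Conj : ∀ {τ π : Fin n → Fin n} → Conj τ π → fix τ ≡ fix π
  fix-Conj {τ} {π} c
    with σ , σ-injective , τσ≡σπ ← Conj⇒conjugator {τ} {π} c
    with σ⁻¹ , σ⁻¹∘σ , σ∘σ⁻¹ ← injective⇒inverse σ-injective = begin
      fix τ                                    ≡⟨ length-filter≡∑𝟙 (λ i → τ i FinP.≟ i) (allFin n) ⟩
      ∑[ i ∈ allFin n ] 𝟙 (τ i FinP.≟ i)       ≡⟨ ∑-reindex (allFin-enumerates n) σ σ⁻¹ σ⁻¹∘σ σ∘σ⁻¹ (λ i → 𝟙 (τ i FinP.≟ i)) ⟨
      ∑[ i ∈ allFin n ] 𝟙 (τ (σ i) FinP.≟ σ i) ≡⟨ ∑-cong (allFin n) fixed-iff ⟩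
      ∑[ i ∈ allFin n ] 𝟙 (π i FinP.≟ i)       ≡⟨ length-filter≡∑𝟙 (λ i → π i FinP.≟ i) (allFin n) ⟨
      fix π                                    ∎
    where
    open ≡-Reasoning
    fixed-iff : ∀ i → 𝟙 (τ (σ i) FinP.≟ σ i) ≡ 𝟙 (π i FinP.≟ i)
    fixed-iff i = 𝟙-⇔ (λ e → σ-injective (trans (sym (τσ≡σπ i)) e)) (λ e → trans (τσ≡σπ i) (cong σ e)) _ _

  reverse-complement : (Fin n → Fin n) → (Fin n → Fin n)
  reverse-complement τ = opposite ∘ τ ∘ opposite

  reverse-complement-involutive : ∀ τ → reverse-complement (reverse-complement τ) ≗ τ
  reverse-complement-involutive τ i = trans (FinP.opposite-involutive _) (cong τ (FinP.opposite-involutive i))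

  opposite-injective : Injective _≡_ _≡_ (opposite {n})
  opposite-injective {i} {j} ρi≡ρj = trans (sym (FinP.opposite-involutive i)) (trans (cong opposite ρi≡ρj) (FinP.opposite-involutive j))

  reverse-complement-injective : ∀ {τ} → Injective _≡_ _≡_ τ → Injective _≡_ _≡_ (reverse-complement τ)
  reverse-complement-injective τ-injective = opposite-injective ∘ τ-injective ∘ opposite-injective

  Conj-reverse-complement : ∀ {τ π} → Conj τ π → Conj (reverse-complement τ) π
  Conj-reverse-complement {τ} {π} c with σ , σ-injective , τσ≡σπ ← Conj⇒conjugator {τ} {π} c =
    conjugator⇒Conj {reverse-complement τ} {π} {opposite ∘ σ} (σ-injective ∘ opposite-injective)
                    (λ i → cong opposite (trans (cong τ (FinP.opposite-involutive (σ i))) (τσ≡σπ i)))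

  opposite-< : ∀ {i j : Fin n} → toℕ i < toℕ j → toℕ (opposite j) < toℕ (opposite i)
  opposite-< {i} {j} i<j = subst₂ _<_ (sym (FinP.opposite-prop j)) (sym (FinP.opposite-prop i))
                                   (ℕP.∸-monoʳ-< (s≤s i<j) (FinP.toℕ<n j))

  <-opposite : ∀ {i j : Fin n} → toℕ i < toℕ (opposite j) → toℕ j < toℕ (opposite i)
  <-opposite {i} {j} i<ρj = subst (λ k → toℕ k < toℕ (opposite i)) (FinP.opposite-involutive j) (opposite-< i<ρj)

  exc≡∑𝟙 : ∀ τ → exc τ ≡ ∑[ i ∈ allFin n ] 𝟙 (toℕ i <? toℕ (τ i))
  exc≡∑𝟙 τ = length-filter≡∑𝟙 (λ i → toℕ i <? toℕ (τ i)) (allFin n)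

  fix≡∑𝟙 : ∀ τ → fix τ ≡ ∑[ i ∈ allFin n ] 𝟙 (toℕ (τ i) ℕ.≟ toℕ i)
  fix≡∑𝟙 τ = trans (length-filter≡∑𝟙 (λ i → τ i FinP.≟ i) (allFin n))
                   (∑-cong (allFin n) (λ i → 𝟙-⇔ (cong toℕ) FinP.toℕ-injective (τ i FinP.≟ i) (toℕ (τ i) ℕ.≟ toℕ i)))

  exc-cong : ∀ {f g : Fin n → Fin n} → f ≗ g → exc f ≡ exc g
  exc-cong {f} {g} f≗g = trans (exc≡∑𝟙 f) (trans (∑-cong (allFin n) (λ i → cong (λ j → 𝟙 (toℕ i <? toℕ j)) (f≗g i))) (sym (exc≡∑𝟙 g)))

  exc-reverse-complement : ∀ τ → exc (reverse-complement τ) ≡ ∑[ i ∈ allFin n ] 𝟙 (toℕ (τ i) <? toℕ i)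
  exc-reverse-complement τ = begin
    exc (reverse-complement τ)                                  ≡⟨ exc≡∑𝟙 (reverse-complement τ) ⟩
    ∑[ i ∈ allFin n ] 𝟙 (toℕ i <? toℕ (opposite (τ (opposite i)))) ≡⟨ ∑-cong (allFin n) flip-< ⟩
    ∑[ i ∈ allFin n ] 𝟙 (toℕ (τ (opposite i)) <? toℕ (opposite i)) ≡⟨ ∑-reindex (allFin-enumerates n) opposite opposite
                                                                        FinP.opposite-involutive FinP.opposite-involutive
                                                                        (λ i → 𝟙 (toℕ (τ i) <? toℕ i)) ⟩
    ∑[ i ∈ allFin n ] 𝟙 (toℕ (τ i) <? toℕ i)                      ∎
    where
    open ≡-Reasoning
    flip-< : ∀ i → 𝟙 (toℕ i <? toℕ (opposite (τ (opposite i)))) ≡ 𝟙 (toℕ (τ (opposite i)) <? toℕ (opposite i))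
    flip-< i = 𝟙-⇔ <-opposite <-opposite _ _

  exc+exc∘reverse-complement+fix : ∀ τ → exc τ + exc (reverse-complement τ) + fix τ ≡ n
  exc+exc∘reverse-complement+fix τ = begin
    exc τ + exc (reverse-complement τ) + fix τ
      ≡⟨ cong₂ _+_ (cong₂ _+_ (exc≡∑𝟙 τ) (exc-reverse-complement τ)) (fix≡∑𝟙 τ) ⟩
    ∑ I up + ∑ I down + ∑ I fixed
      ≡⟨ trans (∑-+ I (λ i → up i + down i) fixed) (cong (_+ ∑ I fixed) (∑-+ I up down)) ⟨
    ∑[ i ∈ I ] (up i + down i + fixed i)
      ≡⟨ ∑-cong I (λ i → 𝟙-trichotomy (toℕ i) (toℕ (τ i))) ⟩
    ∑[ i ∈ I ] 1
      ≡⟨ ∑-const I 1 ⟩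
    length I ℕ.* 1
      ≡⟨ trans (ℕP.*-identityʳ (length I)) (ListP.length-tabulate (λ i → i)) ⟩
    n ∎
    where
    open ≡-Reasoning
    I : List (Fin n)
    I = allFin n
    up down fixed : Fin n → ℕ
    up i = 𝟙 (toℕ i <? toℕ (τ i))
    down i = 𝟙 (toℕ (τ i) <? toℕ i)
    fixed i = 𝟙 (toℕ (τ i) ℕ.≟ toℕ i)

  wexc≡exc+fix : ∀ τ → wexc τ ≡ exc τ + fix τ
  wexc≡exc+fix τ = begin
    wexc τ                                        ≡⟨ length-filter≡∑𝟙 (λ i → toℕ i ≤? toℕ (τ i)) (allFin n) ⟩
    ∑[ i ∈ allFin n ] 𝟙 (toℕ i ≤? toℕ (τ i))      ≡⟨ ∑-cong (allFin n) (λ i → 𝟙-≤ (toℕ i) (toℕ (τ i))) ⟩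
    ∑[ i ∈ allFin n ] (𝟙 (toℕ i <? toℕ (τ i)) + 𝟙 (toℕ (τ i) ℕ.≟ toℕ i)) ≡⟨ ∑-+ (allFin n) _ _ ⟩
    (∑[ i ∈ allFin n ] 𝟙 (toℕ i <? toℕ (τ i))) + (∑[ i ∈ allFin n ] 𝟙 (toℕ (τ i) ℕ.≟ toℕ i)) ≡⟨ cong₂ _+_ (exc≡∑𝟙 τ) (fix≡∑𝟙 τ) ⟨
    exc τ + fix τ                                 ∎
    where open ≡-Reasoning

module _ {n : ℕ} (π : Fin n → Fin n) where

  InClass : (Fin n → Fin n) → Set
  InClass τ = IsPerm τ × Conj τ π

  inClass : (Fin n → Fin n) → ℕ
  inClass τ = 𝟙 (isPerm? τ ×-dec conj? τ π)

  InClass-resp-≗ : ∀ {τ τ′} → τ ≗ τ′ → InClass τ → InClass τ′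
  InClass-resp-≗ τ≗τ′ (perm , conj) = injective⇒IsPerm (injective-resp-≗ τ≗τ′ (IsPerm⇒injective perm)) , Conj-resp-≗ τ≗τ′ conj

  InClass-reverse-complement : ∀ {τ} → InClass τ → InClass (reverse-complement τ)
  InClass-reverse-complement {τ} (perm , conj) =
    injective⇒IsPerm (reverse-complement-injective (IsPerm⇒injective perm)) , Conj-reverse-complement {τ = τ} {π = π} conj

  inClass-cong : ∀ {τ τ′} → τ ≗ τ′ → inClass τ ≡ inClass τ′
  inClass-cong τ≗τ′ = 𝟙-⇔ (InClass-resp-≗ τ≗τ′) (InClass-resp-≗ (sym ∘ τ≗τ′)) _ _

  inClass-reverse-complement : ∀ τ → inClass (reverse-complement τ) ≡ inClass τ
  inClass-reverse-complement τ =
    𝟙-⇔ (InClass-resp-≗ (reverse-complement-involutive τ) ∘ InClass-reverse-complement) InClass-reverse-complement _ _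

  ∑-conjClass : ∀ (s : (Fin n → Fin n) → ℕ) → ∑ (conjClass π) s ≡ ∑[ v ∈ allVecs n n ] inClass (lookup v) ℕ.* s (lookup v)
  ∑-conjClass s = begin
    ∑ (conjClass π) s
      ≡⟨ ∑-filter (λ τ → conj? τ π) (Sn n) s ⟩
    ∑[ τ ∈ Sn n ] 𝟙 (conj? τ π) ℕ.* s τ
      ≡⟨ ∑-filter isPerm? (allMaps n) _ ⟩
    ∑[ τ ∈ allMaps n ] 𝟙 (isPerm? τ) ℕ.* (𝟙 (conj? τ π) ℕ.* s τ)
      ≡⟨ ∑-map (allVecs n n) lookup _ ⟩
    ∑[ v ∈ allVecs n n ] 𝟙 (isPerm? (lookup v)) ℕ.* (𝟙 (conj? (lookup v) π) ℕ.* s (lookup v))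
      ≡⟨ ∑-cong (allVecs n n) (λ v → trans (sym (ℕP.*-assoc (𝟙 (isPerm? (lookup v))) _ _)) (cong (ℕ._* s (lookup v)) (sym (𝟙-×-dec (isPerm? (lookup v)) (conj? (lookup v) π))))) ⟩
    ∑[ v ∈ allVecs n n ] inClass (lookup v) ℕ.* s (lookup v) ∎
    where open ≡-Reasoning

  -- Maps Fin n → Fin n have no decidable equality, so sums over a conjugacy class are
  -- reindexed on their tables in allVecs n n.
  reverse-complementᵛ : Vec (Fin n) n → Vec (Fin n) n
  reverse-complementᵛ v = tabulate (reverse-complement (lookup v))

  reverse-complementᵛ-involutive : ∀ v → reverse-complementᵛ (reverse-complementᵛ v) ≡ v
  reverse-complementᵛ-involutive v = trans
    (VecP.tabulate-cong (λ i → trans (cong opposite (VecP.lookup∘tabulate _ (opposite i))) (reverse-complement-involutive (lookup v) i)))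
    (VecP.tabulate∘lookup v)

  ∑-conjClass-reverse-complement : ∀ (s : (Fin n → Fin n) → ℕ) → (∀ {f g} → f ≗ g → s f ≡ s g) →
                                   ∑[ τ ∈ conjClass π ] s (reverse-complement τ) ≡ ∑ (conjClass π) s
  ∑-conjClass-reverse-complement s s-cong = begin
    ∑[ τ ∈ conjClass π ] s (reverse-complement τ)
      ≡⟨ ∑-conjClass (s ∘ reverse-complement) ⟩
    ∑[ v ∈ allVecs n n ] inClass (lookup v) ℕ.* s (reverse-complement (lookup v))
      ≡⟨ ∑-cong (allVecs n n) as-weight ⟩
    ∑[ v ∈ allVecs n n ] weight (lookup (reverse-complementᵛ v))
      ≡⟨ ∑-reindex (allVecs-enumerates n n) reverse-complementᵛ reverse-complementᵛ
                   reverse-complementᵛ-involutive reverse-complementᵛ-involutive (weight ∘ lookup) ⟩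
    ∑[ v ∈ allVecs n n ] weight (lookup v)
      ≡⟨ ∑-conjClass s ⟨
    ∑ (conjClass π) s ∎
    where
    open ≡-Reasoning
    weight : (Fin n → Fin n) → ℕ
    weight τ = inClass τ ℕ.* s τ
    as-weight : ∀ v → inClass (lookup v) ℕ.* s (reverse-complement (lookup v)) ≡ weight (lookup (reverse-complementᵛ v))
    as-weight v = sym (cong₂ ℕ._*_ (trans (inClass-cong (VecP.lookup∘tabulate _)) (inClass-reverse-complement (lookup v)))
                               (s-cong (VecP.lookup∘tabulate _)))

  ∑-conjClass-fix : ∑ (conjClass π) fix ≡ length (conjClass π) ℕ.* fix π
  ∑-conjClass-fix = trans (cong sum (ListP.map-cong-local (All.map fix-Conj (all-filter (λ τ → conj? τ π) (Sn n)))))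
                          (∑-const (conjClass π) (fix π))

  exc-balance : ∑ (conjClass π) exc + ∑ (conjClass π) exc + length (conjClass π) ℕ.* fix π ≡ length (conjClass π) ℕ.* n
  exc-balance = begin
    ∑ C exc + ∑ C exc + length C ℕ.* fix π
      ≡⟨ cong₂ (λ a b → ∑ C exc + a + b) (∑-conjClass-reverse-complement exc exc-cong) ∑-conjClass-fix ⟨
    ∑ C exc + (∑[ τ ∈ C ] exc (reverse-complement τ)) + ∑ C fix
      ≡⟨ trans (∑-+ C (λ τ → exc τ + exc (reverse-complement τ)) fix) (cong (_+ ∑ C fix) (∑-+ C exc (exc ∘ reverse-complement))) ⟨
    ∑[ τ ∈ C ] (exc τ + exc (reverse-complement τ) + fix τ)
      ≡⟨ ∑-cong C exc+exc∘reverse-complement+fix ⟩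
    ∑[ _ ∈ C ] n
      ≡⟨ ∑-const C n ⟩
    length C ℕ.* n ∎
    where
    open ≡-Reasoning
    C : List (Fin n → Fin n)
    C = conjClass π

  wexc-sum : ∑ (conjClass π) wexc ≡ ∑ (conjClass π) exc + length (conjClass π) ℕ.* fix π
  wexc-sum = trans (∑-cong (conjClass π) wexc≡exc+fix)
                   (trans (∑-+ (conjClass π) exc fix) (cong (_+_ (∑ (conjClass π) exc)) ∑-conjClass-fix))

  conjClass-nonempty : Injective _≡_ _≡_ π → 1 ≤ length (conjClass π)
  conjClass-nonempty π-injective = ∈⇒1≤length (∈-filter⁺ (λ τ → conj? τ π) (tabulate-∈-Sn π-injective)
                                     (conjugator⇒Conj {σ = λ i → i} (λ e → e) (VecP.lookup∘tabulate π)))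

fromℚᵘ-homo-+ : ∀ p q → fromℚᵘ (p ℚᵘ.+ q) ≡ fromℚᵘ p +ℚ fromℚᵘ q
fromℚᵘ-homo-+ p q = toℚᵘ-injective (begin
  toℚᵘ (fromℚᵘ (p ℚᵘ.+ q))              ≈⟨ toℚᵘ-fromℚᵘ (p ℚᵘ.+ q) ⟩
  p ℚᵘ.+ q                              ≈⟨ ℚᵘP.+-cong (toℚᵘ-fromℚᵘ p) (toℚᵘ-fromℚᵘ q) ⟨
  toℚᵘ (fromℚᵘ p) ℚᵘ.+ toℚᵘ (fromℚᵘ q)  ≈⟨ toℚᵘ-homo-+ (fromℚᵘ p) (fromℚᵘ q) ⟨
  toℚᵘ (fromℚᵘ p +ℚ fromℚᵘ q)           ∎)
  where open ℚᵘP.≃-Reasoning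

fromℚᵘ-homo-* : ∀ p q → fromℚᵘ (p ℚᵘ.* q) ≡ fromℚᵘ p * fromℚᵘ q
fromℚᵘ-homo-* p q = toℚᵘ-injective (begin
  toℚᵘ (fromℚᵘ (p ℚᵘ.* q))              ≈⟨ toℚᵘ-fromℚᵘ (p ℚᵘ.* q) ⟩
  p ℚᵘ.* q                              ≈⟨ ℚᵘP.*-cong (toℚᵘ-fromℚᵘ p) (toℚᵘ-fromℚᵘ q) ⟨
  toℚᵘ (fromℚᵘ p) ℚᵘ.* toℚᵘ (fromℚᵘ q)  ≈⟨ toℚᵘ-homo-* (fromℚᵘ p) (fromℚᵘ q) ⟨
  toℚᵘ (fromℚᵘ p * fromℚᵘ q)            ∎)
  where open ℚᵘP.≃-Reasoning

fromℕ : ℕ → ℚ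
fromℕ a = + a / 1

fromℕ-+ : ∀ a b → fromℕ (a + b) ≡ fromℕ a +ℚ fromℕ b
fromℕ-+ a b = trans (cong (_/ 1) (trans (ℤP.pos-+ a b) (sym (cong₂ ℤ._+_ (ℤP.*-identityʳ (+ a)) (ℤP.*-identityʳ (+ b))))))
                    (fromℚᵘ-homo-+ (mkℚᵘ (+ a) 0) (mkℚᵘ (+ b) 0))

fromℕ-* : ∀ a b → fromℕ (a ℕ.* b) ≡ fromℕ a * fromℕ b
fromℕ-* a b = trans (cong (_/ 1) (ℤP.pos-* a b)) (fromℚᵘ-homo-* (mkℚᵘ (+ a) 0) (mkℚᵘ (+ b) 0))

x/d≡x*1/d : ∀ (x : ℤ.ℤ) d → x / suc d ≡ (x / 1) * (+ 1 / suc d)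
x/d≡x*1/d x d = trans (fromℚᵘ-cong {mkℚᵘ x d} {mkℚᵘ x 0 ℚᵘ.* mkℚᵘ (+ 1) d} (*≡* cross))
                      (fromℚᵘ-homo-* (mkℚᵘ x 0) (mkℚᵘ (+ 1) d))
  where
  cross : x ℤ.* + (1 ℕ.* suc d) ≡ (x ℤ.* + 1) ℤ.* + suc d
  cross = trans (cong (λ k → x ℤ.* + k) (ℕP.*-identityˡ (suc d))) (cong (ℤ._* + suc d) (sym (ℤP.*-identityʳ x)))

d*1/d≡1 : ∀ d → fromℕ (suc d) * (+ 1 / suc d) ≡ 1ℚ
d*1/d≡1 d = trans (sym (fromℚᵘ-homo-* (mkℚᵘ (+ suc d) 0) (mkℚᵘ (+ 1) d)))
                  (fromℚᵘ-cong {mkℚᵘ (+ suc d) 0 ℚᵘ.* mkℚᵘ (+ 1) d} {mkℚᵘ (+ 1) 0} (*≡* cross))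
  where
  cross : (+ suc d ℤ.* + 1) ℤ.* + 1 ≡ + 1 ℤ.* + (1 ℕ.* suc d)
  cross = trans (trans (ℤP.*-identityʳ _) (ℤP.*-identityʳ _)) (sym (trans (ℤP.*-identityˡ _) (cong +_ (ℕP.*-identityˡ (suc d)))))

half-of-balance : ∀ (e m x y i : ℚ) → e +ℚ e +ℚ m * x ≡ m * y → m * i ≡ 1ℚ → e * i ≡ (y - x) * ½
half-of-balance e m x y i balance m*i≡1 = begin
  e * i                                 ≡⟨ solve 4 (λ e m x i → e :* i := ((e :+ e :+ m :* x) :- m :* x) :* con ½ :* i) refl e m x i ⟩
  ((e +ℚ e +ℚ m * x) - m * x) * ½ * i   ≡⟨ cong (λ t → (t - m * x) * ½ * i) balance ⟩
  (m * y - m * x) * ½ * i               ≡⟨ solve 4 (λ m x y i → (m :* y :- m :* x) :* con ½ :* i := (y :- x) :* con ½ :* (m :* i)) refl m x y i ⟩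
  (y - x) * ½ * (m * i)                 ≡⟨ cong ((y - x) * ½ *_) m*i≡1 ⟩
  (y - x) * ½ * 1ℚ                      ≡⟨ *-identityʳ _ ⟩
  (y - x) * ½                           ∎
  where open ≡-Reasoning

balance⇒means : ∀ E M n f → 1 ≤ M → E + E + M ℕ.* f ≡ M ℕ.* suc n →
              (divℕ E M ≡ (+ n / 2) * 1ℚ - ½ * (fromℕ f - 1ℚ))
              × (divℕ (E + M ℕ.* f) M ≡ (+ (suc n + 1) / 2) * 1ℚ +ℚ ½ * (fromℕ f - 1ℚ))
balance⇒means E (suc m) n f _ balance = exc-mean , wexc-mean
  where
  open ≡-Reasoning
  e M F N i : ℚ
  e = fromℕ E
  M = fromℕ (suc m)
  F = fromℕ f
  N = fromℕ n
  i = + 1 / suc m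

  balanceℚ : e +ℚ e +ℚ M * F ≡ M * (1ℚ +ℚ N)
  balanceℚ = begin
    e +ℚ e +ℚ M * F               ≡⟨ trans (fromℕ-+ (E + E) _) (cong₂ _+ℚ_ (fromℕ-+ E E) (fromℕ-* (suc m) f)) ⟨
    fromℕ (E + E + suc m ℕ.* f)   ≡⟨ cong fromℕ balance ⟩
    fromℕ (suc m ℕ.* suc n)       ≡⟨ fromℕ-* (suc m) (suc n) ⟩
    M * fromℕ (1 + n)             ≡⟨ cong (M *_) (fromℕ-+ 1 n) ⟩
    M * (1ℚ +ℚ N)                 ∎

  e*i : e * i ≡ (1ℚ +ℚ N - F) * ½
  e*i = half-of-balance e M F (1ℚ +ℚ N) i balanceℚ (d*1/d≡1 m)

  exc-mean : + E / suc m ≡ (+ n / 2) * 1ℚ - ½ * (F - 1ℚ)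
  exc-mean = begin
    + E / suc m                   ≡⟨ x/d≡x*1/d (+ E) m ⟩
    e * i                         ≡⟨ e*i ⟩
    (1ℚ +ℚ N - F) * ½             ≡⟨ solve 2 (λ N F → (con 1ℚ :+ N :- F) :* con ½ := N :* con ½ :* con 1ℚ :- con ½ :* (F :- con 1ℚ)) refl N F ⟩
    N * ½ * 1ℚ - ½ * (F - 1ℚ)     ≡⟨ cong (λ t → t * 1ℚ - ½ * (F - 1ℚ)) (x/d≡x*1/d (+ n) 1) ⟨
    (+ n / 2) * 1ℚ - ½ * (F - 1ℚ) ∎

  wexc-mean : + (E + suc m ℕ.* f) / suc m ≡ (+ (suc n + 1) / 2) * 1ℚ +ℚ ½ * (F - 1ℚ)
  wexc-mean = begin
    + (E + suc m ℕ.* f) / suc m                ≡⟨ x/d≡x*1/d (+ (E + suc m ℕ.* f)) m ⟩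
    fromℕ (E + suc m ℕ.* f) * i                ≡⟨ cong (_* i) (trans (fromℕ-+ E _) (cong (e +ℚ_) (fromℕ-* (suc m) f))) ⟩
    (e +ℚ M * F) * i                           ≡⟨ solve 4 (λ e M F i → (e :+ M :* F) :* i := e :* i :+ F :* (M :* i)) refl e M F i ⟩
    e * i +ℚ F * (M * i)                       ≡⟨ cong₂ (λ a b → a +ℚ F * b) e*i (d*1/d≡1 m) ⟩
    (1ℚ +ℚ N - F) * ½ +ℚ F * 1ℚ                ≡⟨ solve 2 (λ N F → (con 1ℚ :+ N :- F) :* con ½ :+ F :* con 1ℚ := (con 1ℚ :+ (N :+ con 1ℚ)) :* con ½ :* con 1ℚ :+ con ½ :* (F :- con 1ℚ)) refl N F ⟩
    (1ℚ +ℚ (N +ℚ 1ℚ)) * ½ * 1ℚ +ℚ ½ * (F - 1ℚ) ≡⟨ cong (λ t → t * ½ * 1ℚ +ℚ ½ * (F - 1ℚ)) (trans (fromℕ-+ 1 (n + 1)) (cong (1ℚ +ℚ_) (fromℕ-+ n 1))) ⟨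
    fromℕ (suc n + 1) * ½ * 1ℚ +ℚ ½ * (F - 1ℚ) ≡⟨ cong (λ t → t * 1ℚ +ℚ ½ * (F - 1ℚ)) (x/d≡x*1/d (+ (suc n + 1)) 1) ⟨
    (+ (suc n + 1) / 2) * 1ℚ +ℚ ½ * (F - 1ℚ)   ∎

theorem5p1 : (n : ℕ) → 2 ≤ n → (π : Permutation′ n) →
    (mean exc (π ⟨$⟩ʳ_) ≡ (((+ (n ∸ 1)) / 2) * χtriv (π ⟨$⟩ʳ_)) - (((+ 1) / 2) * χstd (π ⟨$⟩ʳ_)))
    × (mean wexc (π ⟨$⟩ʳ_) ≡ (((+ (n + 1)) / 2) * χtriv (π ⟨$⟩ʳ_)) +ℚ (((+ 1) / 2) * χstd (π ⟨$⟩ʳ_)))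
theorem5p1 (suc n) _ π =
  let exc-mean , wexc-mean = balance⇒means (∑ C exc) (length C) n (fix p) (conjClass-nonempty p p-injective) (exc-balance p)
  in exc-mean , trans (cong (λ w → divℕ w (length C)) (wexc-sum p)) wexc-mean
  where
  p : Fin (suc n) → Fin (suc n)
  p = π ⟨$⟩ʳ_
  p-injective : Injective _≡_ _≡_ p
  p-injective px≡py = trans (sym (inverseˡ π)) (trans (cong (π ⟨$⟩ˡ_) px≡py) (inverseˡ π))
  C : List (Fin (suc n) → Fin (suc n))
  C = conjClass p
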